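{- Let $r,n\ge1$ be integers and $c,d\in\mathbb{Z}$; put $\mathscr{d}_1=\gcd(c-d,n)$, $\mathscr{d}_2=\gcd(c+(r-1)d,n)$ and \[M(c,d,r,n)=\mathrm{lcm}\left(\gcd\left(\mathscr{d}_2,\frac{dn}{\mathscr{d}_1}\right),\frac{n}{\gcd(n,r)}\right).\] Write $r=p_1^{\ell_1}\cdots p_j^{\ell_j}$ and $n=p_1^{m_1}\cdots p_j^{m_j}$ with distinct primes $p_i$ and exponents $\ell_i,m_i\ge0$. For each $1\le i\le j$ write $(c-d)\equiv c_ip_i^{s_i}\pmod{p_i^{m_i}}$ and $d\equiv d_ip_i^{t_i}\pmod{p_i^{m_i}}$ with $0\le s_i,t_i\le m_i$ and $c_i,d_i$ relatively prime to $p_i$, and let $\mu_i=\min(m_i,\ell_i)$. Then \[M(c,d,r,n)=\prod_{i=1}^j p_i^{\max(m_i-\mu_i,\ \min(s_i,\ t_i+m_i-s_i))}.\] -}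

module Defs where

open import Data.Nat as ℕ using (ℕ; zero; suc; _*_; _∸_; _⊔_; _⊓_; _^_)
open import Data.Nat.GCD using (gcd)
open import Data.Nat.LCM using (lcm)
open import Data.Fin using (Fin; zero; suc)
open import Data.Integer as ℤ using (ℤ; +_; ∣_∣)
open import Data.Integer.Divisibility as ℤDiv using ()

-- Natural-number division with a junk value when the divisor is 0.
-- Only used with divisors that are nonzero whenever n ≥ 1.
_div_ : ℕ → ℕ → ℕ
a div zero = zero
a div suc k = a ℕ./ suc k

prod : ∀ {j} → (Fin j → ℕ) → ℕ
prod {zero}  f = 1
prod {suc j} f = f zero * prod (λ i → f (suc i))

_≡_[mod_] : ℤ → ℤ → ℕ → Set
x ≡ y [mod q ] = (+ q) ℤDiv.∣ (x ℤ.- y)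

𝒹₁ : ℤ → ℤ → ℕ → ℕ
𝒹₁ c d n = gcd ∣ c ℤ.- d ∣ n

𝒹₂ : ℤ → ℤ → ℕ → ℕ → ℕ
𝒹₂ c d r n = gcd ∣ c ℤ.+ ((+ r) ℤ.- (+ 1)) ℤ.* d ∣ n

-- M(c,d,r,n) = lcm( gcd(𝒹₂, d n / 𝒹₁), n / gcd(n, r) ).
-- gcd with the integer d n / 𝒹₁ only depends on its absolute value |d| n / 𝒹₁.
M : ℤ → ℤ → ℕ → ℕ → ℕ
M c d r n = lcm (gcd (𝒹₂ c d r n) ((∣ d ∣ * n) div 𝒹₁ c d n)) (n div gcd n r)

-- Everything is decided one prime p = pᵢ at a time, with valuations capped at m = mᵢ
-- (the congruences only determine c - d and d modulo p^m).  Then v(c - d) = s and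
-- v(d) = t give v(𝒹₁) = s, v(d n / 𝒹₁) = t + m - s and v(n / gcd(n, r)) = m - μ.
-- If s < t + ℓ, the summands of c + (r - 1) d = (c - d) + r d have distinct valuations,
-- so v(𝒹₂) = s; otherwise t + m - s ≤ m - μ and the gcd-term of M is irrelevant at p.
-- As M divides n, its p-parts determine it.
module Submission where

open import Defs
open import Data.Nat using (ℕ; _*_; _∸_; _⊔_; _⊓_; _^_; _≤_; _+_)
open import Data.Nat.Primality using (Prime)
open import Data.Nat.Coprimality using (Coprime)
open import Data.Fin using (Fin)
open import Data.Integer as ℤ using (ℤ; +_)
open import Function.Definitions using (Injective)
open import Relation.Binary.PropositionalEquality using (_≡_)

open import Data.Nat.Base using (zero; suc; _<_; NonZero; ≢-nonZero; nonTrivial⇒n>1)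
open import Data.Nat.Properties
open import Data.Nat.Divisibility
open import Data.Nat.DivMod using (m/n*n≡m)
open import Data.Nat.GCD using (gcd; gcd[m,n]∣m; gcd[m,n]∣n; gcd-greatest)
open import Data.Nat.LCM using (lcm; lcm-least; m∣lcm[m,n]; n∣lcm[m,n])
open import Data.Nat.Primality
  using (euclidsLemma; prime⇒nonZero; prime⇒nonTrivial; prime⇒irreducible; ¬prime[1])
open import Data.Nat.Coprimality using (coprime-divisor) renaming (sym to coprime-sym)
open import Data.Nat.Induction using (<-wellFounded)
open import Induction.WellFounded using (Acc; acc)
open import Data.Fin using (zero; suc)
import Data.Fin.Properties as Fin
open import Data.Product using (∃; _,_)
open import Data.Sum using (inj₁; inj₂; [_,_]′)
open import Function using (_∘_; _⇔_; mk⇔; Equivalence)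
open import Function.Properties.Equivalence using () renaming (trans to ⇔-trans; sym to ⇔-sym)
open import Relation.Nullary using (yes; no; contradiction)
open import Relation.Binary.PropositionalEquality
  using (_≢_; refl; sym; trans; cong; subst; subst₂; module ≡-Reasoning)
open import Data.Integer.Properties using (abs-*)
import Data.Integer.Divisibility.Signed as ℤ∣
open import Data.Integer.Tactic.RingSolver using (solve-∀)

open Equivalence using (to; from)

m∸n≤o⇔m≤o+n : ∀ {m n o} → m ∸ n ≤ o ⇔ m ≤ o + n
m∸n≤o⇔m≤o+n {m} {n} {o} = mk⇔
  (λ h → subst (m ≤_) (+-comm n o) (≤-trans (m≤n+m∸n m n) (+-monoʳ-≤ n h)))
  (λ h → m≤n+o⇒m∸n≤o m n (subst (m ≤_) (+-comm o n) h))

t+m∸s≤m∸m⊓ℓ : ∀ t ℓ {s} m → t + ℓ ≤ s → t + m ∸ s ≤ m ∸ (m ⊓ ℓ)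
t+m∸s≤m∸m⊓ℓ t ℓ {s} m t+ℓ≤s = begin
  t + m ∸ s        ≤⟨ ∸-monoʳ-≤ (t + m) t+ℓ≤s ⟩
  t + m ∸ (t + ℓ)  ≡⟨ [m+n]∸[m+o]≡n∸o t m ℓ ⟩
  m ∸ ℓ            ≤⟨ ∸-monoʳ-≤ m (m⊓n≤n m ℓ) ⟩
  m ∸ (m ⊓ ℓ)      ∎
  where open ≤-Reasoning

∣⇒≢0 : ∀ {m n} → m ∣ n → n ≢ 0 → m ≢ 0
∣⇒≢0 m∣n n≢0 refl = n≢0 (0∣⇒≡0 m∣n)

div-*-cancel : ∀ {m n} → m ≢ 0 → m ∣ n → n div m * m ≡ n
div-*-cancel {zero}  m≢0 _   = contradiction refl m≢0
div-*-cancel {suc _} _   m∣n = m/n*n≡m m∣n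

div-∣ : ∀ {m n} → m ≢ 0 → m ∣ n → n div m ∣ n
div-∣ {zero}  m≢0 _   = contradiction refl m≢0
div-∣ {suc _} _   m∣n = m/n∣m m∣n

^-monoʳ-∣ : ∀ p {a b} → a ≤ b → p ^ a ∣ p ^ b
^-monoʳ-∣ p {a} {b} a≤b = divides (p ^ (b ∸ a)) (begin
  p ^ b                ≡⟨ cong (p ^_) (m∸n+n≡m a≤b) ⟨
  p ^ (b ∸ a + a)      ≡⟨ ^-distribˡ-+-* p (b ∸ a) a ⟩
  p ^ (b ∸ a) * p ^ a  ∎)
  where open ≡-Reasoning

coprime-^ʳ : ∀ {w p} k → Coprime w p → Coprime w (p ^ k)
coprime-^ʳ zero    _   (_ , i∣1) = ∣1⇒≡1 i∣1
coprime-^ʳ {w} {p} (suc k) w⊥p {i} (i∣w , i∣p*p^k) =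
  coprime-^ʳ k w⊥p (i∣w , coprime-divisor i⊥p i∣p*p^k)
  where
  i⊥p : Coprime i p
  i⊥p (j∣i , j∣p) = w⊥p (∣-trans j∣i i∣w , j∣p)

∤⇒coprime : ∀ {p n} → Prime p → p ∤ n → Coprime n p
∤⇒coprime p-prime p∤n (i∣n , i∣p) with prime⇒irreducible p-prime i∣p
... | inj₁ i≡1 = i≡1
... | inj₂ refl = contradiction i∣n p∤n

coprime⇒∤ : ∀ {p n} → Prime p → Coprime p n → p ∤ n
coprime⇒∤ p-prime p⊥n p∣n = ¬prime[1] (subst Prime (p⊥n (∣-refl , p∣n)) p-prime)

distinct-primes-coprime : ∀ {p q} → Prime p → Prime q → p ≢ q → Coprime p q
distinct-primes-coprime p-prime q-prime p≢q (i∣p , i∣q) with prime⇒irreducible p-prime i∣p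
... | inj₁ i≡1 = i≡1
... | inj₂ refl with prime⇒irreducible q-prime i∣q
...   | inj₁ p≡1 = contradiction (subst Prime p≡1 p-prime) ¬prime[1]
...   | inj₂ p≡q = contradiction p≡q p≢q

prime-∤-^ : ∀ {p q} a → Prime p → Prime q → p ≢ q → p ∤ q ^ a
prime-∤-^ a p-prime q-prime p≢q =
  coprime⇒∤ p-prime (coprime-^ʳ a (distinct-primes-coprime p-prime q-prime p≢q))

∤-* : ∀ {p u v} → Prime p → p ∤ u → p ∤ v → p ∤ u * v
∤-* {u = u} {v} p-prime p∤u p∤v = [ p∤u , p∤v ]′ ∘ euclidsLemma u v p-prime

^∣*⇔∣ : ∀ p k a {x} → .{{NonZero p}} → p ^ k ∣ x * p ^ a ⇔ p ^ (k ∸ a) ∣ x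
^∣*⇔∣ p k a {x} with k ≤? a
... | yes k≤a = mk⇔ (λ _ → subst (λ e → p ^ e ∣ x) (sym (m≤n⇒m∸n≡0 k≤a)) (1∣ x))
                    (λ _ → ∣-trans (^-monoʳ-∣ p k≤a) (n∣m*n x))
... | no k≰a = subst (λ e → p ^ e ∣ x * p ^ a ⇔ p ^ (k ∸ a) ∣ x) (m∸n+n≡m a≤k)
                (mk⇔ (*-cancelʳ-∣ (p ^ a) {{m^n≢0 p a}} ∘ subst (_∣ x * p ^ a) p^[k∸a+a]≡)
                     (subst (_∣ x * p ^ a) (sym p^[k∸a+a]≡) ∘ *-monoˡ-∣ (p ^ a)))
  where
  a≤k : a ≤ k
  a≤k = <⇒≤ (≰⇒> k≰a)
  p^[k∸a+a]≡ : p ^ (k ∸ a + a) ≡ p ^ (k ∸ a) * p ^ a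
  p^[k∸a+a]≡ = ^-distribˡ-+-* p (k ∸ a) a

-- Exact and truncated p-adic valuations

infix 4 _^_∥_ _^_∥_upTo_

record _^_∥_ (p a n : ℕ) : Set where
  constructor exactly
  field
    cofactor   : ℕ
    n≡p^a*     : n ≡ p ^ a * cofactor
    p∤cofactor : p ∤ cofactor

-- min (v_p n) m ≡ min e m; unlike p ^ e ∥ n this is informative for n = 0.
record _^_∥_upTo_ (p e n m : ℕ) : Set where
  constructor truncated
  field
    ∣⇔≤ : ∀ {k} → k ≤ m → p ^ k ∣ n ⇔ k ≤ e

open _^_∥_upTo_

∥upTo-mono : ∀ {p e n m m′} → m′ ≤ m → p ^ e ∥ n upTo m → p ^ e ∥ n upTo m′
∥upTo-mono m′≤m h = truncated λ k≤m′ → ∣⇔≤ h (≤-trans k≤m′ m′≤m)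

∥upTo-gcd : ∀ {p a b x y m} → p ^ a ∥ x upTo m → p ^ b ∥ y upTo m → p ^ (a ⊓ b) ∥ gcd x y upTo m
∥upTo-gcd {a = a} {b} {x} {y} hx hy = truncated λ k≤m → mk⇔
  (λ h → ⊓-glb (to (∣⇔≤ hx k≤m) (∣-trans h (gcd[m,n]∣m x y)))
               (to (∣⇔≤ hy k≤m) (∣-trans h (gcd[m,n]∣n x y))))
  (λ h → gcd-greatest (from (∣⇔≤ hx k≤m) (≤-trans h (m⊓n≤m a b)))
                      (from (∣⇔≤ hy k≤m) (≤-trans h (m⊓n≤n a b))))

m≡m-n+n : ∀ m n → m ≡ m ℤ.- n ℤ.+ n
m≡m-n+n = solve-∀

module _ {k : ℕ} where

  ∣∣-+ : ∀ x y → k ∣ ℤ.∣ x ∣ → k ∣ ℤ.∣ y ∣ → k ∣ ℤ.∣ x ℤ.+ y ∣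
  ∣∣-+ x y k∣x k∣y = ℤ∣.∣⇒∣ᵤ {k = + k} {i = x ℤ.+ y}
    (ℤ∣.∣m∣n⇒∣m+n (ℤ∣.∣ᵤ⇒∣ {k = + k} {i = x} k∣x) (ℤ∣.∣ᵤ⇒∣ {k = + k} {i = y} k∣y))

  ∣∣-+-cancelʳ : ∀ x y → k ∣ ℤ.∣ x ℤ.+ y ∣ → k ∣ ℤ.∣ y ∣ → k ∣ ℤ.∣ x ∣
  ∣∣-+-cancelʳ x y k∣x+y k∣y = ℤ∣.∣⇒∣ᵤ {k = + k} {i = x}
    (ℤ∣.∣m+n∣n⇒∣m (ℤ∣.∣ᵤ⇒∣ {k = + k} {i = x ℤ.+ y} k∣x+y) (ℤ∣.∣ᵤ⇒∣ {k = + k} {i = y} k∣y))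

  ∣∣-cong : ∀ x y → k ∣ ℤ.∣ x ℤ.- y ∣ → k ∣ ℤ.∣ x ∣ ⇔ k ∣ ℤ.∣ y ∣
  ∣∣-cong x y k∣x-y = mk⇔
    (λ k∣x → ℤ∣.∣⇒∣ᵤ {k = + k} {i = y} (ℤ∣.∣m+n∣m⇒∣n
      (ℤ∣.∣ᵤ⇒∣ {k = + k} {i = x ℤ.- y ℤ.+ y} (subst (λ z → k ∣ ℤ.∣ z ∣) (m≡m-n+n x y) k∣x))
      (ℤ∣.∣ᵤ⇒∣ {k = + k} {i = x ℤ.- y} k∣x-y)))
    (λ k∣y → subst (λ z → k ∣ ℤ.∣ z ∣) (sym (m≡m-n+n x y)) (∣∣-+ (x ℤ.- y) y k∣x-y k∣y))

∥upTo-resp-≡mod : ∀ {p e m} x y → x ≡ y [mod p ^ m ] →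
                  p ^ e ∥ ℤ.∣ y ∣ upTo m → p ^ e ∥ ℤ.∣ x ∣ upTo m
∥upTo-resp-≡mod {p} x y x≡y h = truncated λ k≤m →
  ⇔-trans (∣∣-cong x y (∣-trans (^-monoʳ-∣ p k≤m) x≡y)) (∣⇔≤ h k≤m)

∥upTo-+ : ∀ {p a b m} x y → p ^ a ∥ ℤ.∣ x ∣ upTo m → p ^ b ∥ ℤ.∣ y ∣ upTo m → a < b →
          p ^ a ∥ ℤ.∣ x ℤ.+ y ∣ upTo m
∥upTo-+ {p} {a} x y hx hy a<b = truncated λ {k} k≤m → mk⇔
  (λ h → ≮⇒≥ λ a<k →
    let 1+a≤m = ≤-trans a<k k≤m in
    1+n≰n (to (∣⇔≤ hx 1+a≤m)
                (∣∣-+-cancelʳ x y (∣-trans (^-monoʳ-∣ p a<k) h) (from (∣⇔≤ hy 1+a≤m) a<b))))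
  (λ k≤a → ∣∣-+ x y (from (∣⇔≤ hx k≤m) k≤a) (from (∣⇔≤ hy k≤m) (≤-trans k≤a (<⇒≤ a<b))))

module _ {p : ℕ} (p-prime : Prime p) where

  private instance
    p≢0 : NonZero p
    p≢0 = prime⇒nonZero p-prime

  p>1 : 1 < p
  p>1 = nonTrivial⇒n>1 p {{prime⇒nonTrivial p-prime}}

  ^∣^⇒≤ : ∀ {a b} → p ^ a ∣ p ^ b → a ≤ b
  ^∣^⇒≤ {a} {b} h = ≮⇒≥ λ b<a → <⇒≱ (^-monoʳ-< p p>1 b<a) (∣⇒≤ {{m^n≢0 p b}} h)

  ^∣*⇒^∣ : ∀ k {u n} → p ∤ u → p ^ k ∣ u * n → p ^ k ∣ n
  ^∣*⇒^∣ k p∤u = coprime-divisor (coprime-sym (coprime-^ʳ k (∤⇒coprime p-prime p∤u)))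

  ∥⇒∣⇔≤ : ∀ {a n} → p ^ a ∥ n → ∀ k → p ^ k ∣ n ⇔ k ≤ a
  ∥⇒∣⇔≤ {a} (exactly w refl p∤w) k = mk⇔
    (λ h → ^∣^⇒≤ (^∣*⇒^∣ k p∤w (subst (p ^ k ∣_) (*-comm (p ^ a) w) h)))
    (λ k≤a → ∣m⇒∣m*n w (^-monoʳ-∣ p k≤a))

  ∣∧∤⇒∥ : ∀ {a n} → p ^ a ∣ n → p ^ suc a ∤ n → p ^ a ∥ n
  ∣∧∤⇒∥ {a} (divides w refl) p^1+a∤n = exactly w (*-comm w (p ^ a)) (p^1+a∤n ∘ *-monoˡ-∣ (p ^ a))

  ∥-*ˡ⇔ : ∀ {a u n} → p ∤ u → p ^ a ∥ u * n ⇔ p ^ a ∥ n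
  ∥-*ˡ⇔ {a} {u} p∤u = mk⇔
    (λ h → ∣∧∤⇒∥ (^∣*⇒^∣ a p∤u (from (∥⇒∣⇔≤ h a) ≤-refl))
                 (1+n≰n ∘ to (∥⇒∣⇔≤ h (suc a)) ∘ ∣n⇒∣m*n u))
    (λ h → ∣∧∤⇒∥ (∣n⇒∣m*n u (from (∥⇒∣⇔≤ h a) ≤-refl))
                 (1+n≰n ∘ to (∥⇒∣⇔≤ h (suc a)) ∘ ^∣*⇒^∣ (suc a) p∤u))

  ∥-lcm : ∀ {a b x y} → p ^ a ∥ x → p ^ b ∥ y → p ^ (a ⊔ b) ∥ lcm x y
  ∥-lcm {a} {b} (exactly u refl p∤u) (exactly v refl p∤v) = ∣∧∤⇒∥ p^[a⊔b]∣lcm p^[1+a⊔b]∤lcm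
    where
    lcm∣ : lcm (p ^ a * u) (p ^ b * v) ∣ p ^ (a ⊔ b) * (u * v)
    lcm∣ = lcm-least (*-pres-∣ (^-monoʳ-∣ p (m≤m⊔n a b)) (m∣m*n v))
                     (*-pres-∣ (^-monoʳ-∣ p (m≤n⊔m a b)) (n∣m*n u))
    p^[a⊔b]∣lcm : p ^ (a ⊔ b) ∣ lcm (p ^ a * u) (p ^ b * v)
    p^[a⊔b]∣lcm with ⊔-sel a b
    ... | inj₁ a⊔b≡a = subst (λ e → p ^ e ∣ lcm (p ^ a * u) (p ^ b * v)) (sym a⊔b≡a)
                         (∣-trans (m∣m*n u) (m∣lcm[m,n] (p ^ a * u) (p ^ b * v)))
    ... | inj₂ a⊔b≡b = subst (λ e → p ^ e ∣ lcm (p ^ a * u) (p ^ b * v)) (sym a⊔b≡b)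
                         (∣-trans (m∣m*n v) (n∣lcm[m,n] (p ^ a * u) (p ^ b * v)))
    p^[1+a⊔b]∤lcm : p ^ suc (a ⊔ b) ∤ lcm (p ^ a * u) (p ^ b * v)
    p^[1+a⊔b]∤lcm h =
      1+n≰n (to (∥⇒∣⇔≤ (exactly (u * v) refl (∤-* p-prime p∤u p∤v)) (suc (a ⊔ b))) (∣-trans h lcm∣))

  ∥-exists : ∀ n → n ≢ 0 → ∃ λ a → p ^ a ∥ n
  ∥-exists n = go n (<-wellFounded n)
    where
    go : ∀ n → Acc _<_ n → n ≢ 0 → ∃ λ a → p ^ a ∥ n
    go n (acc rec) n≢0 with p ∣? n
    ... | no p∤n = 0 , exactly n (sym (*-identityˡ n)) p∤n
    ... | yes (divides q refl) with go q (rec (m<m*n q p {{≢-nonZero q≢0}} p>1)) q≢0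
      where
      q≢0 : q ≢ 0
      q≢0 refl = n≢0 refl
    ...   | a , exactly w refl p∤w =
            suc a , exactly w (trans (*-comm (p ^ a * w) p) (sym (*-assoc p (p ^ a) w))) p∤w

  ∥⇒∥upTo : ∀ {a n m} → p ^ a ∥ n → p ^ a ∥ n upTo m
  ∥⇒∥upTo h = truncated λ {k} _ → ∥⇒∣⇔≤ h k

  ∥upTo⇒∥ : ∀ {e x m n} → x ∣ n → p ^ m ∥ n → p ^ e ∥ x upTo m → e ≤ m → p ^ e ∥ x
  ∥upTo⇒∥ {e} x∣n n-exact hx e≤m = ∣∧∤⇒∥ (from (∣⇔≤ hx e≤m) ≤-refl)
    λ h → 1+n≰n (to (∣⇔≤ hx (to (∥⇒∣⇔≤ n-exact (suc e)) (∣-trans h x∣n))) h)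

  ≡unit*^⇒∥upTo : ∀ {s m} x u → x ≡ u ℤ.* (+ (p ^ s)) [mod p ^ m ] → Coprime ℤ.∣ u ∣ p →
                  p ^ s ∥ ℤ.∣ x ∣ upTo m
  ≡unit*^⇒∥upTo {s} x u x≡ u⊥p = ∥upTo-resp-≡mod x (u ℤ.* + (p ^ s)) x≡ (∥⇒∥upTo
    (exactly ℤ.∣ u ∣ (trans (abs-* u (+ (p ^ s))) (*-comm ℤ.∣ u ∣ (p ^ s)))
                     (coprime⇒∤ p-prime (coprime-sym u⊥p))))

  ∥⇒∣*⇔∣*^ : ∀ {a w} → p ^ a ∥ w → ∀ k x → p ^ k ∣ x * w ⇔ p ^ k ∣ x * p ^ a
  ∥⇒∣*⇔∣*^ {a} (exactly w refl p∤w) k x = mk⇔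
    (λ h → ^∣*⇒^∣ k p∤w (subst (p ^ k ∣_) x*[y*z]≡z*[x*y] h))
    (λ h → ∣-trans h (subst (x * p ^ a ∣_) (*-assoc x (p ^ a) w) (m∣m*n w)))
    where
    x*[y*z]≡z*[x*y] : x * (p ^ a * w) ≡ w * (x * p ^ a)
    x*[y*z]≡z*[x*y] = trans (sym (*-assoc x (p ^ a) w)) (*-comm (x * p ^ a) w)

  ∥upTo-*-∥ : ∀ {e a x w m} → p ^ e ∥ x upTo m → p ^ a ∥ w → p ^ (e + a) ∥ x * w upTo (m + a)
  ∥upTo-*-∥ {a = a} {x} hx w-exact = truncated λ {k} k≤m+a →
    ⇔-trans (∥⇒∣*⇔∣*^ w-exact k x)
      (⇔-trans (^∣*⇔∣ p k a) (⇔-trans (∣⇔≤ hx (from m∸n≤o⇔m≤o+n k≤m+a)) m∸n≤o⇔m≤o+n))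

  ∥upTo-cancel : ∀ {e a x w y m} → x * w ≡ y → p ^ a ∥ w → p ^ (e + a) ∥ y upTo (m + a) →
                 p ^ e ∥ x upTo m
  ∥upTo-cancel {e} {a} {x} refl w-exact hy = truncated λ {k} k≤m → ⇔-trans
    (subst (λ i → p ^ i ∣ x ⇔ p ^ (k + a) ∣ x * p ^ a) (m+n∸n≡m k a) (⇔-sym (^∣*⇔∣ p (k + a) a)))
    (⇔-trans (⇔-sym (∥⇒∣*⇔∣*^ w-exact (k + a) x))
      (⇔-trans (∣⇔≤ hy (+-monoˡ-≤ a k≤m)) (mk⇔ (+-cancelʳ-≤ a k e) (+-monoˡ-≤ a))))

c+[r-1]d≡c-d+rd : ∀ c d r → c ℤ.+ (r ℤ.- + 1) ℤ.* d ≡ c ℤ.- d ℤ.+ r ℤ.* d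
c+[r-1]d≡c-d+rd = solve-∀

dn/𝒹₁ : ℤ → ℤ → ℕ → ℕ
dn/𝒹₁ c d n = (ℤ.∣ d ∣ * n) div 𝒹₁ c d n

M₁ : ℤ → ℤ → ℕ → ℕ → ℕ
M₁ c d r n = gcd (𝒹₂ c d r n) (dn/𝒹₁ c d n)

M₂ : ℕ → ℕ → ℕ
M₂ r n = n div gcd n r

𝒹₁≢0 : ∀ c d {n} → n ≢ 0 → 𝒹₁ c d n ≢ 0
𝒹₁≢0 c d {n} = ∣⇒≢0 (gcd[m,n]∣n ℤ.∣ c ℤ.- d ∣ n)

gcd[n,r]≢0 : ∀ {n} r → n ≢ 0 → gcd n r ≢ 0
gcd[n,r]≢0 {n} r = ∣⇒≢0 (gcd[m,n]∣m n r)

M₁∣n : ∀ c d r n → M₁ c d r n ∣ n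
M₁∣n c d r n =
  ∣-trans (gcd[m,n]∣m (𝒹₂ c d r n) (dn/𝒹₁ c d n)) (gcd[m,n]∣n ℤ.∣ c ℤ.+ (+ r ℤ.- + 1) ℤ.* d ∣ n)

M₂∣n : ∀ r {n} → n ≢ 0 → M₂ r n ∣ n
M₂∣n r {n} n≢0 = div-∣ (gcd[n,r]≢0 r n≢0) (gcd[m,n]∣m n r)

M∣n : ∀ c d r {n} → n ≢ 0 → M c d r n ∣ n
M∣n c d r {n} n≢0 = lcm-least (M₁∣n c d r n) (M₂∣n r n≢0)

module _ {p m ℓ s t n r : ℕ} {c d u v : ℤ}
  (p-prime : Prime p) (n≢0 : n ≢ 0) (n-exact : p ^ m ∥ n) (r-exact : p ^ ℓ ∥ r) (s≤m : s ≤ m)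
  (c-d≡ : (c ℤ.- d) ≡ u ℤ.* (+ (p ^ s)) [mod p ^ m ]) (u⊥p : Coprime ℤ.∣ u ∣ p)
  (d≡ : d ≡ v ℤ.* (+ (p ^ t)) [mod p ^ m ]) (v⊥p : Coprime ℤ.∣ v ∣ p) where

  private
    n-val : ∀ {m′} → p ^ m ∥ n upTo m′
    n-val = ∥⇒∥upTo p-prime n-exact

    c-d-val : p ^ s ∥ ℤ.∣ c ℤ.- d ∣ upTo m
    c-d-val = ≡unit*^⇒∥upTo p-prime (c ℤ.- d) u c-d≡ u⊥p

    d-val : p ^ t ∥ ℤ.∣ d ∣ upTo m
    d-val = ≡unit*^⇒∥upTo p-prime d v d≡ v⊥p

    rd-val : p ^ (t + ℓ) ∥ ℤ.∣ + r ℤ.* d ∣ upTo m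
    rd-val = subst (λ z → p ^ (t + ℓ) ∥ z upTo m) (trans (*-comm ℤ.∣ d ∣ r) (sym (abs-* (+ r) d)))
      (∥upTo-mono (m≤m+n m ℓ) (∥upTo-*-∥ p-prime d-val r-exact))

    𝒹₁-exact : p ^ s ∥ 𝒹₁ c d n
    𝒹₁-exact = ∥upTo⇒∥ p-prime (gcd[m,n]∣n ℤ.∣ c ℤ.- d ∣ n) n-exact
      (subst (λ e → p ^ e ∥ 𝒹₁ c d n upTo m) (m≤n⇒m⊓n≡m s≤m) (∥upTo-gcd c-d-val n-val)) s≤m

    dn/𝒹₁-val : p ^ (t + m ∸ s) ∥ dn/𝒹₁ c d n upTo m
    dn/𝒹₁-val = ∥upTo-cancel p-prime
      (div-*-cancel (𝒹₁≢0 c d n≢0) (∣-trans (gcd[m,n]∣n ℤ.∣ c ℤ.- d ∣ n) (n∣m*n ℤ.∣ d ∣))) 𝒹₁-exact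
      (subst (λ e → p ^ e ∥ ℤ.∣ d ∣ * n upTo (m + s)) (sym (m∸n+n≡m (≤-trans s≤m (m≤n+m m t))))
        (∥upTo-mono (+-monoʳ-≤ m s≤m) (∥upTo-*-∥ p-prime d-val n-exact)))

    𝒹₂-val : s < t + ℓ → p ^ s ∥ 𝒹₂ c d r n upTo m
    𝒹₂-val s<t+ℓ = subst₂ (λ z e → p ^ e ∥ gcd ℤ.∣ z ∣ n upTo m)
      (sym (c+[r-1]d≡c-d+rd c d (+ r))) (m≤n⇒m⊓n≡m s≤m)
      (∥upTo-gcd (∥upTo-+ (c ℤ.- d) (+ r ℤ.* d) c-d-val rd-val s<t+ℓ) n-val)

    M₁-exact : s < t + ℓ → p ^ (s ⊓ (t + m ∸ s)) ∥ M₁ c d r n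
    M₁-exact s<t+ℓ = ∥upTo⇒∥ p-prime (M₁∣n c d r n) n-exact
      (∥upTo-gcd (𝒹₂-val s<t+ℓ) dn/𝒹₁-val) (≤-trans (m⊓n≤m s _) s≤m)

    M₁-exponent≤ : ∀ {a} → p ^ a ∥ M₁ c d r n → a ≤ t + m ∸ s
    M₁-exponent≤ {a} a-exact =
      to (∣⇔≤ dn/𝒹₁-val a≤m) (∣-trans p^a∣M₁ (gcd[m,n]∣n (𝒹₂ c d r n) (dn/𝒹₁ c d n)))
      where
      p^a∣M₁ : p ^ a ∣ M₁ c d r n
      p^a∣M₁ = from (∥⇒∣⇔≤ p-prime a-exact a) ≤-refl
      a≤m : a ≤ m
      a≤m = to (∥⇒∣⇔≤ p-prime n-exact a) (∣-trans p^a∣M₁ (M₁∣n c d r n))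

    gcd[n,r]-exact : p ^ (m ⊓ ℓ) ∥ gcd n r
    gcd[n,r]-exact = ∥upTo⇒∥ p-prime (gcd[m,n]∣m n r) n-exact
      (∥upTo-gcd n-val (∥⇒∥upTo p-prime r-exact)) (m⊓n≤m m ℓ)

    M₂-exact : p ^ (m ∸ (m ⊓ ℓ)) ∥ M₂ r n
    M₂-exact = ∥upTo⇒∥ p-prime (M₂∣n r n≢0) n-exact
      (∥upTo-cancel p-prime (div-*-cancel (gcd[n,r]≢0 r n≢0) (gcd[m,n]∣m n r)) gcd[n,r]-exact
        (subst (λ e → p ^ e ∥ n upTo (m + m ⊓ ℓ)) (sym (m∸n+n≡m (m⊓n≤m m ℓ))) n-val))
      (m∸n≤m m (m ⊓ ℓ))

  M-exact : p ^ ((m ∸ (m ⊓ ℓ)) ⊔ (s ⊓ (t + m ∸ s))) ∥ M c d r n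
  M-exact with s <? t + ℓ
  ... | yes s<t+ℓ = subst (λ e → p ^ e ∥ M c d r n) (⊔-comm (s ⊓ (t + m ∸ s)) (m ∸ (m ⊓ ℓ)))
                          (∥-lcm p-prime (M₁-exact s<t+ℓ) M₂-exact)
  ... | no s≮t+ℓ with ∥-exists p-prime (M₁ c d r n) (∣⇒≢0 (M₁∣n c d r n) n≢0)
  ...   | a , a-exact =
          subst (λ e → p ^ e ∥ M c d r n) (trans (m≤n⇒m⊔n≡n a≤) (sym (m≥n⇒m⊔n≡m s⊓x≤)))
                (∥-lcm p-prime a-exact M₂-exact)
    where
    x≤ : t + m ∸ s ≤ m ∸ (m ⊓ ℓ)
    x≤ = t+m∸s≤m∸m⊓ℓ t ℓ m (≮⇒≥ s≮t+ℓ)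
    a≤ : a ≤ m ∸ (m ⊓ ℓ)
    a≤ = ≤-trans (M₁-exponent≤ a-exact) x≤
    s⊓x≤ : s ⊓ (t + m ∸ s) ≤ m ∸ (m ⊓ ℓ)
    s⊓x≤ = ≤-trans (m⊓n≤n s _) x≤

prime-∤-prod : ∀ {j q} {p : Fin j → ℕ} (e : Fin j → ℕ) →
               Prime q → (∀ i → Prime (p i)) → (∀ i → q ≢ p i) → q ∤ prod (λ i → p i ^ e i)
prime-∤-prod {zero}  _ q-prime _      _   q∣1 = ¬prime[1] (subst Prime (∣1⇒≡1 q∣1) q-prime)
prime-∤-prod {suc _} e q-prime primes q≢p =
  ∤-* q-prime (prime-∤-^ (e zero) q-prime (primes zero) (q≢p zero))
              (prime-∤-prod (e ∘ suc) q-prime (primes ∘ suc) (q≢p ∘ suc))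

module _ {j} {p : Fin (suc j) → ℕ}
         (primes : ∀ i → Prime (p i)) (p-injective : Injective _≡_ _≡_ p) where

  tail-∤-head^ : ∀ a i → p (suc i) ∤ p zero ^ a
  tail-∤-head^ a i = prime-∤-^ a (primes (suc i)) (primes zero) (Fin.0≢1+n ∘ sym ∘ p-injective)

  head-∤-tail-prod : ∀ (e : Fin j → ℕ) → p zero ∤ prod (λ i → p (suc i) ^ e i)
  head-∤-tail-prod e = prime-∤-prod e (primes zero) (primes ∘ suc) (λ _ → Fin.0≢1+n ∘ p-injective)

^∥prod : ∀ {j} {p : Fin j → ℕ} (e : Fin j → ℕ) → (∀ i → Prime (p i)) → Injective _≡_ _≡_ p →
         ∀ i → p i ^ e i ∥ prod (λ i → p i ^ e i)
^∥prod e primes p-injective zero = exactly _ refl (head-∤-tail-prod primes p-injective (e ∘ suc))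
^∥prod e primes p-injective (suc i) =
  from (∥-*ˡ⇔ (primes (suc i)) (tail-∤-head^ primes p-injective (e zero) i))
       (^∥prod (e ∘ suc) (primes ∘ suc) (Fin.suc-injective ∘ p-injective) i)

∥⇒≡prod : ∀ {j x} {p : Fin j → ℕ} (e m : Fin j → ℕ) → (∀ i → Prime (p i)) → Injective _≡_ _≡_ p →
          x ∣ prod (λ i → p i ^ m i) → (∀ i → p i ^ e i ∥ x) → x ≡ prod (λ i → p i ^ e i)
∥⇒≡prod {zero} _ _ _ _ x∣1 _ = ∣1⇒≡1 x∣1
∥⇒≡prod {suc _} {p = p} e m primes p-injective x∣ x-exact with x-exact zero
... | exactly w refl p₀∤w = cong (p zero ^ e zero *_)
        (∥⇒≡prod (e ∘ suc) (m ∘ suc) (primes ∘ suc) (Fin.suc-injective ∘ p-injective) w∣ w-exact)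
  where
  w∣ : w ∣ prod (λ i → p (suc i) ^ m (suc i))
  w∣ = coprime-divisor (coprime-^ʳ (m zero) (∤⇒coprime (primes zero) p₀∤w))
                       (∣-trans (n∣m*n (p zero ^ e zero)) x∣)
  w-exact : ∀ i → p (suc i) ^ e (suc i) ∥ w
  w-exact i =
    to (∥-*ˡ⇔ (primes (suc i)) (tail-∤-head^ primes p-injective (e zero) i)) (x-exact (suc i))

proposition6p2 :
    (r n : ℕ) → 1 ≤ r → 1 ≤ n → (c d : ℤ) →
    (j : ℕ) (p : Fin j → ℕ) (ℓ m : Fin j → ℕ) →
    (∀ i → Prime (p i)) → Injective _≡_ _≡_ p →
    r ≡ prod (λ i → p i ^ ℓ i) → n ≡ prod (λ i → p i ^ m i) →
    (s t : Fin j → ℕ) (cᵢ dᵢ : Fin j → ℤ) →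
    (∀ i → (c ℤ.- d) ≡ cᵢ i ℤ.* (+ (p i ^ s i)) [mod p i ^ m i ]) →
    (∀ i → d ≡ dᵢ i ℤ.* (+ (p i ^ t i)) [mod p i ^ m i ]) →
    (∀ i → s i ≤ m i) → (∀ i → t i ≤ m i) →
    (∀ i → Coprime ℤ.∣ cᵢ i ∣ (p i)) → (∀ i → Coprime ℤ.∣ dᵢ i ∣ (p i)) →
    M c d r n ≡ prod (λ i → p i ^ ((m i ∸ (m i ⊓ ℓ i)) ⊔ (s i ⊓ (t i + m i ∸ s i))))
proposition6p2 r n _ 1≤n c d j p ℓ m primes p-injective r≡ n≡ s t cᵢ dᵢ c-d≡ d≡ s≤m _ cᵢ⊥p dᵢ⊥p =
  ∥⇒≡prod _ m primes p-injective (subst (M c d r n ∣_) n≡ (M∣n c d r n≢0)) λ i →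
    M-exact {t = t i} {c = c} {d} {cᵢ i} {dᵢ i} (primes i) n≢0
            (subst (p i ^ m i ∥_) (sym n≡) (^∥prod m primes p-injective i))
            (subst (p i ^ ℓ i ∥_) (sym r≡) (^∥prod ℓ primes p-injective i))
            (s≤m i) (c-d≡ i) (cᵢ⊥p i) (d≡ i) (dᵢ⊥p i)
  where
  n≢0 : n ≢ 0
  n≢0 = m<n⇒n≢0 1≤n
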